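{- Let $\mathcal{E}$ be an extended transition system, $a$ an agent and $\psi$ an effect formula. If $\mathcal{E}\models \mathsf{G}\big(\psi\rightarrow\exists X.\,\mathtt{K}_a(X\overset{\mathit{Act}}{\rightsquigarrow}\psi)\big)$ (FCE), then $\mathcal{E}\models \mathsf{G}\big(\psi\rightarrow\exists X.\,\mathtt{K}_a(X\overset{\mathit{Act}(a)}{\rightsquigarrow}\psi)\big)$ (ICE) and $\mathcal{E}\models \mathsf{G}\big(\psi\rightarrow\exists X.\,\mathtt{K}_a(X\overset{\mathit{Act}\setminus\mathit{Act}(a)}{\rightsquigarrow}\psi)\big)$ (ECE).
   Context: A transition system is $\mathcal{T}=(S,S_0,\Delta,\mathrm{AP},\Lambda)$ with finite states $S$, initial states $S_0$, $\Delta:S\to 2^S$ with nonempty images, atomic propositions $\mathrm{AP}$, edge labelling $\Lambda:S\times S\to 2^{\mathrm{AP}}$. Paths $\rho\in S^\omega$ satisfy $\rho[i+1]\in\Delta(\rho[i])$; the trace is $\pi[i]=\Lambda(\rho[i],\rho[i+1])$; $\Pi(\mathcal{T})$ is the set of traces of paths starting in $S_0$. An extended transition system is $\mathcal{E}=(\mathcal{T},\Omega,\mathit{Act})$ for agents $\mathrm{AG}$, with $\Omega,\mathit{Act}:\mathrm{AG}\to 2^{\mathrm{AP}}$, $\mathit{Act}(a)\subseteq\Omega(a)$; $\mathit{Act}$ also denotes the union of all $\mathit{Act}(a)$. Every action set is available from every state: for all $s$ and $B\subseteq\mathit{Act}$ there is $s'\in\Delta(s)$ with $\Lambda(s,s')\cap\mathit{Act}=B$.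 $\Omega_a(\pi)[i]=\pi[i]\cap\Omega(a)$; $\pi[0,i]$ is the length-$(i+1)$ prefix; $\pi=_B\pi'$ means $\pi[i]\cap B=\pi'[i]\cap B$ for all $i$. Similarity: $\pi\oplus_A\pi'=\{(p,i)\in A\times\mathbb{N}\mid p\in\pi[i]\oplus\pi'[i]\}$ and $\pi\le^A_{\pi'}\pi''$ iff $(\pi\oplus_A\pi')\subseteq(\pi''\oplus_A\pi')$. Temporal cause: $\mathit{Cause}(\psi,\pi,i,A)=\{\pi'\in(2^A)^\omega\mid\forall\pi''\in\Pi(\mathcal{T}).\ (\pi''\le^A_\pi\pi'\wedge\pi=_{\mathit{Act}\setminus A}\pi'')\rightarrow\mathcal{E},\pi'',i\models\psi\}$. The formulas are in the logic YLTL$^2$: LTL with past (atoms $p\in\mathrm{AP}$, Booleans, next $\mathsf{X}$, until $\mathsf{U}$, previous $\mathsf{Y}$, since $\mathsf{U}^-$, and derived $\mathsf{F}\varphi=\top\mathsf{U}\varphi$, $\mathsf{G}\varphi=\neg\mathsf{F}\neg\varphi$) extended with knowledge $\mathtt{K}_a\varphi$, second-order quantification $\exists X.\varphi$ and causal predicates $X\overset{A}{\rightsquigarrow}\varphi$. Semantics relative to $\mathcal{E}$, trace $\pi$, time $i$, assignment $\Theta$ of sets of traces to second-order variables: temporal operators as usual for LTL with past; $\mathtt{K}_a\varphi$ holds iff $\varphi$ holds at $i$ on every $\pi'\in\Pi(\mathcal{T})$ with $\Omega_a(\pi)[0,i]=\Omega_a(\pi')[0,i]$; $\exists X.\varphi$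 iff some $Y\subseteq(2^{\mathrm{AP}})^\omega$ makes $\varphi$ hold under $\Theta[X\mapsto Y]$; $X\overset{A}{\rightsquigarrow}\varphi$ iff $\Theta(X)=\mathit{Cause}(\varphi,\pi,i,A)$. $\mathcal{E}\models\varphi$ iff $\varphi$ holds at time $0$ of every $\pi\in\Pi(\mathcal{T})$ under the empty assignment. The effect $\psi$ is a formula with no free second-order variables. -}

module Defs where

open import Data.Nat using (ℕ; zero; suc; _≤_; _<_)
open import Data.Fin using (Fin; zero; suc)
open import Data.Fin.Subset using (Subset; _∈_; _⊆_; _∩_; _─_; ⋃; Nonempty)
open import Data.List using (map; allFin)
open import Data.Product using (Σ; ∃; _×_; _,_)
open import Data.Empty using (⊥)
open import Data.Unit.Polymorphic using (⊤)
open import Data.Sum using (_⊎_)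
open import Relation.Nullary using (¬_)
open import Relation.Binary.PropositionalEquality using (_≡_)
open import Level using (Level) renaming (suc to lsuc; zero to lzero)

-- Extended transition systems.
-- States: Fin nS.  Atomic propositions: Fin m (sets of APs = Subset m).
-- Agents: Fin k.

ActAllOf : ∀ {m k} → (Fin k → Subset m) → Subset m
ActAllOf {k = k} Act = ⋃ (map Act (allFin k))

record ETS (nS m k : ℕ) : Set where
  field
    S0         : Subset nS
    Δ          : Fin nS → Subset nS
    Δ-nonempty : ∀ s → Nonempty (Δ s)
    Λ          : Fin nS → Fin nS → Subset m
    Ω          : Fin k → Subset m
    Act        : Fin k → Subset m
    Act⊆Ω      : ∀ a → Act a ⊆ Ω a
    avail      : ∀ s (B : Subset m) → B ⊆ ActAllOf Act →
                 ∃ λ s' → s' ∈ Δ s × Λ s s' ∩ ActAllOf Act ≡ B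

  ActAll : Subset m
  ActAll = ActAllOf Act

Trace : ℕ → Set
Trace m = ℕ → Subset m

TraceSet : ℕ → Set₁
TraceSet m = Trace m → Set

module _ {nS m k : ℕ} (E : ETS nS m k) where
  open ETS E

  IsInitPath : (ℕ → Fin nS) → Set
  IsInitPath ρ = ρ 0 ∈ S0 × (∀ i → ρ (suc i) ∈ Δ (ρ i))

  InΠ : Trace m → Set
  InΠ π = ∃ λ ρ → IsInitPath ρ × (∀ i → π i ≡ Λ (ρ i) (ρ (suc i)))

_∈⊕_,_ : ∀ {m} → Fin m → Subset m → Subset m → Set
p ∈⊕ X , Y = (p ∈ X × ¬ p ∈ Y) ⊎ (¬ p ∈ X × p ∈ Y)

InDiff : ∀ {m} → Subset m → Trace m → Trace m → Fin m → ℕ → Set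
InDiff A π π' p i = p ∈ A × p ∈⊕ π i , π' i

Closer : ∀ {m} → Subset m → Trace m → Trace m → Trace m → Set
Closer A π π' π'' = ∀ p i → InDiff A π π' p i → InDiff A π'' π' p i

EqOn : ∀ {m} → Subset m → Trace m → Trace m → Set
EqOn B π π' = ∀ i → π i ∩ B ≡ π' i ∩ B

-- YLTL² syntax, second-order variables as de Bruijn indices Fin n

data Formula (m k : ℕ) : ℕ → Set where
  tt     : ∀ {n} → Formula m k n
  atom   : ∀ {n} → Fin m → Formula m k n
  ¬'     : ∀ {n} → Formula m k n → Formula m k n
  _∧'_   : ∀ {n} → Formula m k n → Formula m k n → Formula m k n
  _∨'_   : ∀ {n} → Formula m k n → Formula m k n → Formula m k n
  _⇒'_   : ∀ {n} → Formula m k n → Formula m k n → Formula m k n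
  X'     : ∀ {n} → Formula m k n → Formula m k n
  _U'_   : ∀ {n} → Formula m k n → Formula m k n → Formula m k n
  Y'     : ∀ {n} → Formula m k n → Formula m k n
  _S'_   : ∀ {n} → Formula m k n → Formula m k n → Formula m k n
  F'     : ∀ {n} → Formula m k n → Formula m k n
  G'     : ∀ {n} → Formula m k n → Formula m k n
  K'     : ∀ {n} → Fin k → Formula m k n → Formula m k n
  ∃'     : ∀ {n} → Formula m k (suc n) → Formula m k n
  cause  : ∀ {n} → Fin n → Subset m → Formula m k n → Formula m k n

ext : ∀ {n n'} → (Fin n → Fin n') → Fin (suc n) → Fin (suc n')
ext ρ zero    = zero
ext ρ (suc x) = suc (ρ x)

rename : ∀ {m k n n'} → (Fin n → Fin n') → Formula m k n → Formula m k n'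
rename ρ tt          = tt
rename ρ (atom p)    = atom p
rename ρ (¬' φ)      = ¬' (rename ρ φ)
rename ρ (φ ∧' ψ)    = rename ρ φ ∧' rename ρ ψ
rename ρ (φ ∨' ψ)    = rename ρ φ ∨' rename ρ ψ
rename ρ (φ ⇒' ψ)    = rename ρ φ ⇒' rename ρ ψ
rename ρ (X' φ)      = X' (rename ρ φ)
rename ρ (φ U' ψ)    = rename ρ φ U' rename ρ ψ
rename ρ (Y' φ)      = Y' (rename ρ φ)
rename ρ (φ S' ψ)    = rename ρ φ S' rename ρ ψ
rename ρ (F' φ)      = F' (rename ρ φ)
rename ρ (G' φ)      = G' (rename ρ φ)
rename ρ (K' a φ)    = K' a (rename ρ φ)
rename ρ (∃' φ)      = ∃' (rename (ext ρ) φ)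
rename ρ (cause x A φ) = cause (ρ x) A (rename ρ φ)

wk : ∀ {m k n} → Formula m k n → Formula m k (suc n)
wk = rename suc

Assignment : ℕ → ℕ → Set₁
Assignment m n = Fin n → TraceSet m

extendΘ : ∀ {m n} → Assignment m n → TraceSet m → Assignment m (suc n)
extendΘ Θ Y zero    = Y
extendΘ Θ Y (suc x) = Θ x

emptyΘ : ∀ {m} → Assignment m 0
emptyΘ ()

module Semantics {nS m k : ℕ} (E : ETS nS m k) where
  open ETS E

  CauseMem : (sem : Trace m → ℕ → Set₁) → Trace m → ℕ → Subset m →
             Trace m → Set₁
  CauseMem sem π i A π' =
    (∀ j → π' j ⊆ A) ×
    (∀ π'' → InΠ E π'' → Closer A π'' π π' → EqOn (ActAll ─ A) π π'' →
       sem π'' i)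

  sat : ∀ {n} → Assignment m n → Trace m → ℕ → Formula m k n → Set₁
  sat Θ π i tt          = ⊤
  sat Θ π i (atom p)    = Level.Lift (lsuc lzero) (p ∈ π i)
  sat Θ π i (¬' φ)      = ¬ sat Θ π i φ
  sat Θ π i (φ ∧' ψ)    = sat Θ π i φ × sat Θ π i ψ
  sat Θ π i (φ ∨' ψ)    = sat Θ π i φ ⊎ sat Θ π i ψ
  sat Θ π i (φ ⇒' ψ)    = sat Θ π i φ → sat Θ π i ψ
  sat Θ π i (X' φ)      = sat Θ π (suc i) φ
  sat Θ π i (φ U' ψ)    =
    ∃ λ j → Level.Lift (lsuc lzero) (i ≤ j) × sat Θ π j ψ ×
            (∀ l → i ≤ l → l < j → sat Θ π l φ)
  sat Θ π zero    (Y' φ) = Level.Lift (lsuc lzero) ⊥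
  sat Θ π (suc i) (Y' φ) = sat Θ π i φ
  sat Θ π i (φ S' ψ)    =
    ∃ λ j → Level.Lift (lsuc lzero) (j ≤ i) × sat Θ π j ψ ×
            (∀ l → j < l → l ≤ i → sat Θ π l φ)
  sat Θ π i (F' φ)      = ∃ λ j → Level.Lift (lsuc lzero) (i ≤ j) × sat Θ π j φ
  sat Θ π i (G' φ)      = ∀ j → i ≤ j → sat Θ π j φ
  sat Θ π i (K' a φ)    =
    ∀ π' → InΠ E π' → (∀ j → j ≤ i → π j ∩ Ω a ≡ π' j ∩ Ω a) →
      sat Θ π' i φ
  sat Θ π i (∃' φ)      = Σ (TraceSet m) λ Y → sat (extendΘ Θ Y) π i φ
  sat Θ π i (cause x A φ) =
    ∀ π' → (Θ x π' → CauseMem (λ ρ j → sat Θ ρ j φ) π i A π') ×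
           (CauseMem (λ ρ j → sat Θ ρ j φ) π i A π' → Θ x π')

  Models : Formula m k 0 → Set₁
  Models φ = ∀ π → InΠ E π → sat emptyΘ π 0 φ

open Semantics public

KnownCause : ∀ {m k} → Fin k → Subset m → Formula m k 0 → Formula m k 0
KnownCause a A ψ = G' (ψ ⇒' ∃' (K' a (cause zero A (wk ψ))))

{-# OPTIONS --safe #-}
module Submission where

-- For the full action set Act the side condition of Cause is void, and the
-- A-causes can be read off the Act-causes: x is an A-cause at π iff x ⊆ A and
-- its overlay (x on A, the actions of π on Act ∖ A) is an Act-cause at π, while
-- x ⊆ A is an A-cause at π' as soon as its overlay with any trace is an
-- Act-cause at π'. Hence traces with the same Act-causes have the same A-causes.
-- Under FCE the Act-cause is the same set at every trace the agent cannot
-- distinguish from π, so the same holds for the A-cause, which the agent thus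
-- knows.

open import Defs
open import Data.Nat using (ℕ; zero; suc; _≤_; z≤n)
open import Data.Fin using (Fin; zero; suc)
open import Data.Fin.Subset using (Subset; _∈_; _∉_; _⊆_; _∩_; _∪_; _─_; ⋃; inside; outside)
open import Data.Fin.Subset.Properties
  using (_∈?_; x∈p∩q⁺; x∈p∩q⁻; x∈p∪q⁺; x∈p∪q⁻; ⊆-antisym; p⊆p∪q; q⊆p∪q; p─q⊆p; x∈p∧x∉q⇒x∈p─q)
open import Data.Product using (_×_; _,_; proj₁; proj₂)
open import Data.Product.Function.NonDependent.Propositional using (_×-⇔_)
import Data.Product.Function.Dependent.Propositional as Σ
open import Data.Sum using (inj₁; inj₂)
open import Data.Sum.Function.Propositional using (_⊎-⇔_)
open import Data.Empty using (⊥-elim)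
open import Data.List using (List; _∷_)
import Data.List.Relation.Unary.Any as Any
import Data.List.Membership.Propositional as List
open import Data.List.Membership.Propositional.Properties using (∈-allFin; ∈-map⁺)
open import Data.Vec.Base using (_∷_; here; there)
open import Function using (_∘_)
open import Function.Bundles using (_⇔_; mk⇔; module Equivalence)
open import Function.Construct.Identity using (⇔-id)
open import Function.Construct.Symmetry using (⇔-sym)
open import Function.Related.TypeIsomorphisms using (→-cong-⇔; ¬-cong-⇔)
open import Relation.Nullary using (¬_; yes; no)
open import Relation.Binary.PropositionalEquality using (_≡_; refl; subst; sym)

open Equivalence using (to; from)

Π-cong-⇔ : ∀ {a b c} {A : Set a} {B : A → Set b} {C : A → Set c} →
           (∀ x → B x ⇔ C x) → ((x : A) → B x) ⇔ ((x : A) → C x)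
Π-cong-⇔ B⇔C = mk⇔ (λ f x → to (B⇔C x) (f x)) (λ f x → from (B⇔C x) (f x))

private
  variable
    n : ℕ

x∈p─q⇒x∉q : ∀ {p q : Subset n} {x} → x ∈ p ─ q → x ∉ q
x∈p─q⇒x∉q {p = inside ∷ _} {q = outside ∷ _} here ()
x∈p─q⇒x∉q {p = _ ∷ _}      {q = _ ∷ _}       (there x∈p─q) (there x∈q) = x∈p─q⇒x∉q x∈p─q x∈q

⊆-⋃ : ∀ {xs : List (Subset n)} {p} → p List.∈ xs → p ⊆ ⋃ xs
⊆-⋃ {xs = _ ∷ xs} (Any.here refl) = p⊆p∪q (⋃ xs)
⊆-⋃ {xs = x ∷ xs} (Any.there p∈xs) = q⊆p∪q x (⋃ xs) ∘ ⊆-⋃ p∈xs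

∩-≡⁺ : ∀ {X Y B : Subset n} → (∀ {p} → p ∈ B → p ∈ X ⇔ p ∈ Y) → X ∩ B ≡ Y ∩ B
∩-≡⁺ X⇔Y = ⊆-antisym
  (λ p∈X∩B → let p∈X , p∈B = x∈p∩q⁻ _ _ p∈X∩B in x∈p∩q⁺ (to (X⇔Y p∈B) p∈X , p∈B))
  (λ p∈Y∩B → let p∈Y , p∈B = x∈p∩q⁻ _ _ p∈Y∩B in x∈p∩q⁺ (from (X⇔Y p∈B) p∈Y , p∈B))

∩-≡⁻ : ∀ {X Y B : Subset n} → X ∩ B ≡ Y ∩ B → ∀ {p} → p ∈ B → p ∈ X ⇔ p ∈ Y
∩-≡⁻ {B = B} X∩B≡Y∩B {p} p∈B = mk⇔ (transport X∩B≡Y∩B) (transport (sym X∩B≡Y∩B))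
  where
  transport : ∀ {X Y} → X ∩ B ≡ Y ∩ B → p ∈ X → p ∈ Y
  transport X∩B≡Y∩B p∈X = proj₁ (x∈p∩q⁻ _ B (subst (_ ∈_) X∩B≡Y∩B (x∈p∩q⁺ (p∈X , p∈B))))

∈⊕-sym : ∀ {p} {X Y : Subset n} → p ∈⊕ X , Y → p ∈⊕ Y , X
∈⊕-sym (inj₁ (p∈X , p∉Y)) = inj₂ (p∉Y , p∈X)
∈⊕-sym (inj₂ (p∉X , p∈Y)) = inj₁ (p∈Y , p∉X)

∈⊕-respˡ : ∀ {p} {X X' Y : Subset n} → p ∈ X ⇔ p ∈ X' → p ∈⊕ X , Y → p ∈⊕ X' , Y
∈⊕-respˡ X⇔X' (inj₁ (p∈X , p∉Y)) = inj₁ (to X⇔X' p∈X , p∉Y)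
∈⊕-respˡ X⇔X' (inj₂ (p∉X , p∈Y)) = inj₂ (p∉X ∘ from X⇔X' , p∈Y)

⇔⇒∉⊕ : ∀ {p} {X Y : Subset n} → p ∈ X ⇔ p ∈ Y → ¬ p ∈⊕ X , Y
⇔⇒∉⊕ X⇔Y (inj₁ (p∈X , p∉Y)) = p∉Y (to X⇔Y p∈X)
⇔⇒∉⊕ X⇔Y (inj₂ (p∉X , p∈Y)) = p∉X (from X⇔Y p∈Y)

∉⊕⇒⇔ : ∀ {p} {X Y : Subset n} → ¬ p ∈⊕ X , Y → p ∈ X ⇔ p ∈ Y
∉⊕⇒⇔ {p = p} {X = X} {Y = Y} p∉X⊕Y with p ∈? X | p ∈? Y
... | yes p∈X | yes p∈Y = mk⇔ (λ _ → p∈Y) (λ _ → p∈X)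
... | no  p∉X | no  p∉Y = mk⇔ (⊥-elim ∘ p∉X) (⊥-elim ∘ p∉Y)
... | yes p∈X | no  p∉Y = ⊥-elim (p∉X⊕Y (inj₁ (p∈X , p∉Y)))
... | no  p∉X | yes p∈Y = ⊥-elim (p∉X⊕Y (inj₂ (p∉X , p∈Y)))

module _ (U A : Subset n) where

  overlay : Subset n → Subset n → Subset n
  overlay P X = X ∪ (P ∩ (U ─ A))

  overlay-⊆ : ∀ {P X} → A ⊆ U → X ⊆ A → overlay P X ⊆ U
  overlay-⊆ {P} {X} A⊆U X⊆A p∈ with x∈p∪q⁻ X _ p∈
  ... | inj₁ p∈X  = A⊆U (X⊆A p∈X)
  ... | inj₂ p∈P∩ = p─q⊆p U A (proj₂ (x∈p∩q⁻ P _ p∈P∩))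

  ∈-overlay-inside : ∀ {P X p} → p ∈ A → p ∈ overlay P X ⇔ p ∈ X
  ∈-overlay-inside {P} {X} {p} p∈A = mk⇔ from-overlay (x∈p∪q⁺ ∘ inj₁)
    where
    from-overlay : p ∈ overlay P X → p ∈ X
    from-overlay p∈ with x∈p∪q⁻ X _ p∈
    ... | inj₁ p∈X  = p∈X
    ... | inj₂ p∈P∩ = ⊥-elim (x∈p─q⇒x∉q (proj₂ (x∈p∩q⁻ P _ p∈P∩)) p∈A)

  ∈-overlay-outside : ∀ {P X p} → X ⊆ A → p ∈ U ─ A → p ∈ overlay P X ⇔ p ∈ P
  ∈-overlay-outside {P} {X} {p} X⊆A p∈U─A =
    mk⇔ from-overlay (λ p∈P → x∈p∪q⁺ (inj₂ (x∈p∩q⁺ (p∈P , p∈U─A))))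
    where
    from-overlay : p ∈ overlay P X → p ∈ P
    from-overlay p∈ with x∈p∪q⁻ X _ p∈
    ... | inj₁ p∈X  = ⊥-elim (x∈p─q⇒x∉q p∈U─A (X⊆A p∈X))
    ... | inj₂ p∈P∩ = proj₁ (x∈p∩q⁻ P _ p∈P∩)

module _ {nS m k : ℕ} (E : ETS nS m k) where
  open ETS E

  CauseMem-cong : ∀ {sem₁ sem₂ : Trace m → ℕ → Set₁} → (∀ π i → sem₁ π i ⇔ sem₂ π i) →
                  ∀ {π i A x} → CauseMem E sem₁ π i A x ⇔ CauseMem E sem₂ π i A x
  CauseMem-cong sem₁⇔sem₂ {i = i} =
    ⇔-id _ ×-⇔ Π-cong-⇔ λ π'' → Π-cong-⇔ λ _ → Π-cong-⇔ λ _ → Π-cong-⇔ λ _ → sem₁⇔sem₂ π'' i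

  sat-rename : ∀ {n n'} {ρ : Fin n → Fin n'} {Θ : Assignment m n} {Θ' : Assignment m n'} →
               (∀ x π → Θ' (ρ x) π ⇔ Θ x π) →
               ∀ φ π i → sat E Θ' π i (rename ρ φ) ⇔ sat E Θ π i φ
  sat-rename Θ'∘ρ⇔Θ tt            π i = ⇔-id _
  sat-rename Θ'∘ρ⇔Θ (atom p)      π i = ⇔-id _
  sat-rename Θ'∘ρ⇔Θ (¬' φ)        π i = ¬-cong-⇔ (sat-rename Θ'∘ρ⇔Θ φ π i)
  sat-rename Θ'∘ρ⇔Θ (φ ∧' ψ)      π i = sat-rename Θ'∘ρ⇔Θ φ π i ×-⇔ sat-rename Θ'∘ρ⇔Θ ψ π i
  sat-rename Θ'∘ρ⇔Θ (φ ∨' ψ)      π i = sat-rename Θ'∘ρ⇔Θ φ π i ⊎-⇔ sat-rename Θ'∘ρ⇔Θ ψ π i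
  sat-rename Θ'∘ρ⇔Θ (φ ⇒' ψ)      π i = →-cong-⇔ (sat-rename Θ'∘ρ⇔Θ φ π i) (sat-rename Θ'∘ρ⇔Θ ψ π i)
  sat-rename Θ'∘ρ⇔Θ (X' φ)        π i = sat-rename Θ'∘ρ⇔Θ φ π (suc i)
  sat-rename Θ'∘ρ⇔Θ (φ U' ψ)      π i = Σ.congˡ λ {j} →
    ⇔-id _ ×-⇔ sat-rename Θ'∘ρ⇔Θ ψ π j ×-⇔
    Π-cong-⇔ λ l → Π-cong-⇔ λ _ → Π-cong-⇔ λ _ → sat-rename Θ'∘ρ⇔Θ φ π l
  sat-rename Θ'∘ρ⇔Θ (Y' φ)        π zero    = ⇔-id _
  sat-rename Θ'∘ρ⇔Θ (Y' φ)        π (suc i) = sat-rename Θ'∘ρ⇔Θ φ π i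
  sat-rename Θ'∘ρ⇔Θ (φ S' ψ)      π i = Σ.congˡ λ {j} →
    ⇔-id _ ×-⇔ sat-rename Θ'∘ρ⇔Θ ψ π j ×-⇔
    Π-cong-⇔ λ l → Π-cong-⇔ λ _ → Π-cong-⇔ λ _ → sat-rename Θ'∘ρ⇔Θ φ π l
  sat-rename Θ'∘ρ⇔Θ (F' φ)        π i = Σ.congˡ λ {j} → ⇔-id _ ×-⇔ sat-rename Θ'∘ρ⇔Θ φ π j
  sat-rename Θ'∘ρ⇔Θ (G' φ)        π i = Π-cong-⇔ λ j → Π-cong-⇔ λ _ → sat-rename Θ'∘ρ⇔Θ φ π j
  sat-rename Θ'∘ρ⇔Θ (K' a φ)      π i =
    Π-cong-⇔ λ π' → Π-cong-⇔ λ _ → Π-cong-⇔ λ _ → sat-rename Θ'∘ρ⇔Θ φ π' i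
  sat-rename {ρ = ρ} {Θ} {Θ'} Θ'∘ρ⇔Θ (∃' φ) π i = Σ.congˡ λ {Y} → sat-rename (under-binder Y) φ π i
    where
    under-binder : ∀ Y x π → extendΘ Θ' Y (ext ρ x) π ⇔ extendΘ Θ Y x π
    under-binder Y zero    π = ⇔-id _
    under-binder Y (suc x) π = Θ'∘ρ⇔Θ x π
  sat-rename Θ'∘ρ⇔Θ (cause x A φ) π i = Π-cong-⇔ λ π' →
    →-cong-⇔ (Θ'∘ρ⇔Θ x π') (CauseMem-cong (sat-rename Θ'∘ρ⇔Θ φ)) ×-⇔
    →-cong-⇔ (CauseMem-cong (sat-rename Θ'∘ρ⇔Θ φ)) (Θ'∘ρ⇔Θ x π')

  sat-wk : ∀ ψ {Y : TraceSet m} π i → sat E (extendΘ emptyΘ Y) π i (wk ψ) ⇔ sat E emptyΘ π i ψ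
  sat-wk ψ = sat-rename (λ ()) ψ

  Cause : Formula m k 0 → Trace m → ℕ → Subset m → Trace m → Set₁
  Cause ψ = CauseMem E (λ π i → sat E emptyΘ π i ψ)

  sat-cause-wk : ∀ ψ {Y : TraceSet m} {π i A} →
                 sat E (extendΘ emptyΘ Y) π i (cause zero A (wk ψ)) ⇔ (∀ x → Y x ⇔ Cause ψ π i A x)
  sat-cause-wk ψ {Y} {π} {i} {A} = Π-cong-⇔ λ x → mk⇔
    (λ (Y⇒C , C⇒Y) → mk⇔ (to wk⇔ ∘ Y⇒C) (C⇒Y ∘ from wk⇔))
    (λ Y⇔C → from wk⇔ ∘ to Y⇔C , from Y⇔C ∘ to wk⇔)
    where
    wk⇔ : ∀ {x} → CauseMem E (λ π i → sat E (extendΘ emptyΘ Y) π i (wk ψ)) π i A x ⇔ Cause ψ π i A x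
    wk⇔ = CauseMem-cong (sat-wk ψ)

  module Overlay (sem : Trace m → ℕ → Set₁) {A : Subset m} (A⊆Act : A ⊆ ActAll) where

    overlayTrace : Trace m → Trace m → Trace m
    overlayTrace π x i = overlay ActAll A (π i) (x i)

    cause-overlay : ∀ {π i x} → CauseMem E sem π i A x → CauseMem E sem π i ActAll (overlayTrace π x)
    cause-overlay {π} {x = x} (x⊆A , x-cause) =
      (λ l → overlay-⊆ ActAll A A⊆Act (x⊆A l)) ,
      λ π'' π''∈Π closer _ → x-cause π'' π''∈Π (closer-on-A closer) (agree-outside-A closer)
      where
      closer-on-A : ∀ {π''} → Closer ActAll π'' π (overlayTrace π x) → Closer A π'' π x
      closer-on-A closer p l (p∈A , p∈π''⊕π) =
        p∈A , ∈⊕-respˡ (∈-overlay-inside ActAll A p∈A) (proj₂ (closer p l (A⊆Act p∈A , p∈π''⊕π)))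
      agree-outside-A : ∀ {π''} → Closer ActAll π'' π (overlayTrace π x) → EqOn (ActAll ─ A) π π''
      agree-outside-A closer l = ∩-≡⁺ λ p∈Act─A → ∉⊕⇒⇔ λ p∈π⊕π'' →
        ⇔⇒∉⊕ (∈-overlay-outside ActAll A (x⊆A l) p∈Act─A)
             (proj₂ (closer _ l (p─q⊆p ActAll A p∈Act─A , ∈⊕-sym p∈π⊕π'')))

    cause-unoverlay : ∀ {π₁ π₂ i x} → (∀ l → x l ⊆ A) →
                      CauseMem E sem π₂ i ActAll (overlayTrace π₁ x) → CauseMem E sem π₂ i A x
    cause-unoverlay {π₁} {π₂} {x = x} x⊆A (_ , y-cause) =
      x⊆A , λ π'' π''∈Π closer agree →
        y-cause π'' π''∈Π (closer-on-Act closer agree) (λ _ → ∩-≡⁺ vacuous)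
      where
      vacuous : ∀ {p X Y} → p ∈ ActAll ─ ActAll → p ∈ X ⇔ p ∈ Y
      vacuous p∈Act─Act = ⊥-elim (x∈p─q⇒x∉q p∈Act─Act (p─q⊆p ActAll ActAll p∈Act─Act))
      closer-on-Act : ∀ {π''} → Closer A π'' π₂ x → EqOn (ActAll ─ A) π₂ π'' →
                      Closer ActAll π'' π₂ (overlayTrace π₁ x)
      closer-on-Act closer agree p l (p∈Act , p∈π''⊕π₂) with p ∈? A
      ... | yes p∈A =
        p∈Act , ∈⊕-respˡ (⇔-sym (∈-overlay-inside ActAll A p∈A)) (proj₂ (closer p l (p∈A , p∈π''⊕π₂)))
      ... | no  p∉A = ⊥-elim (⇔⇒∉⊕ (∩-≡⁻ (sym (agree l)) (x∈p∧x∉q⇒x∈p─q p∈Act p∉A)) p∈π''⊕π₂)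

    cause-transfer : ∀ {π π' i} → (∀ y → CauseMem E sem π i ActAll y → CauseMem E sem π' i ActAll y) →
                     ∀ {x} → CauseMem E sem π i A x → CauseMem E sem π' i A x
    cause-transfer Cπ⊆Cπ' x-cause = cause-unoverlay (proj₁ x-cause) (Cπ⊆Cπ' _ (cause-overlay x-cause))

  Indistinguishable : Fin k → ℕ → Trace m → Trace m → Set
  Indistinguishable a i π π' = ∀ j → j ≤ i → π j ∩ Ω a ≡ π' j ∩ Ω a

  knownCause-restrict : ∀ a ψ {A} → A ⊆ ActAll →
                        Models E (KnownCause a ActAll ψ) → Models E (KnownCause a A ψ)
  knownCause-restrict a ψ {A} A⊆Act fce π π∈Π i _ ψ-at-i =
    Yₐ , λ π' π'∈Π π~π' → from (sat-cause-wk ψ) (Yₐ-is-cause π' π'∈Π π~π')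
    where
    open Overlay (λ π i → sat E emptyΘ π i ψ) A⊆Act
    Y : TraceSet m
    Y = proj₁ (fce π π∈Π i z≤n ψ-at-i)
    Y-is-cause : ∀ π' → InΠ E π' → Indistinguishable a i π π' → ∀ y → Y y ⇔ Cause ψ π' i ActAll y
    Y-is-cause π' π'∈Π π~π' = to (sat-cause-wk ψ) (proj₂ (fce π π∈Π i z≤n ψ-at-i) π' π'∈Π π~π')
    -- Cause ψ π i A itself lives in Set₁; this is its Set-sized description.
    Yₐ : TraceSet m
    Yₐ x = (∀ l → x l ⊆ A) × Y (overlayTrace π x)
    Yₐ-is-cause : ∀ π' → InΠ E π' → Indistinguishable a i π π' → ∀ x → Yₐ x ⇔ Cause ψ π' i A x
    Yₐ-is-cause π' π'∈Π π~π' x = mk⇔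
      (λ (x⊆A , y) → cause-unoverlay x⊆A (to (Y-at-π' _) y))
      (λ x-cause → proj₁ x-cause , from (Y-at-π _) (cause-overlay (cause-transfer Cπ'⊆Cπ x-cause)))
      where
      Y-at-π' : ∀ y → Y y ⇔ Cause ψ π' i ActAll y
      Y-at-π' = Y-is-cause π' π'∈Π π~π'
      Y-at-π : ∀ y → Y y ⇔ Cause ψ π i ActAll y
      Y-at-π = Y-is-cause π π∈Π (λ _ _ → refl)
      Cπ'⊆Cπ : ∀ y → Cause ψ π' i ActAll y → Cause ψ π i ActAll y
      Cπ'⊆Cπ y = to (Y-at-π y) ∘ from (Y-at-π' y)

proposition1 : ∀ {nS m k : ℕ} (E : ETS nS m k) (a : Fin k) (ψ : Formula m k 0) →
    Models E (KnownCause a (ETS.ActAll E) ψ) →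
    Models E (KnownCause a (ETS.Act E a) ψ) ×
    Models E (KnownCause a (ETS.ActAll E ─ ETS.Act E a) ψ)
proposition1 E a ψ fce =
  knownCause-restrict E a ψ (⊆-⋃ (∈-map⁺ Act (∈-allFin a))) fce ,
  knownCause-restrict E a ψ (p─q⊆p ActAll (Act a)) fce
  where open ETS E
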